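{- Let $\mathbf{B}$ be a topological Boolean algebra, $\nabla$ an open filter and $\Delta$ a closed ideal of $\mathbf{B}$, and $\mathbf{T}=Tw(\mathbf{B},\nabla,\Delta)$. Then $\neg_{\mathcal{G}(\mathbf{B})}\neg_{\mathcal{G}(\mathbf{B})}a\in\Delta_{\mathsf{G}}(\mathbf{T})$ for all $a\in\Delta_{\mathsf{G}}(\mathbf{T})$.
   Context: A topological Boolean algebra (TBA) is an algebra $\mathbf{B}=\langle B;\vee,\wedge,\to,\bot,\Box\rangle$ whose reduct is a Boolean algebra (top $1$, $\neg a:=a\to\bot$) with $\Box 1=1$, $\Box(a\wedge b)=\Box a\wedge\Box b$, $\Box a\le a$, $\Box a\le\Box\Box a$; $\Diamond a:=\neg\Box\neg a$. $\mathsf{G}(\mathbf{B})=\{a\in B:\Box a=a\}$ and $\mathcal{G}(\mathbf{B})$ is the Heyting algebra on $\mathsf{G}(\mathbf{B})$ with $\vee,\wedge,\bot$ of $\mathbf{B}$ and $a\to_{\mathcal{G}(\mathbf{B})}b:=\Box(a\to b)$; thus $\neg_{\mathcal{G}(\mathbf{B})}a=\Box\neg a$. A filter is open if closed under $\Box$; an ideal is closed if closed under $\Diamond$. $Tw(\mathbf{B},\nabla,\Delta)=\{(a,b)\in B\times B: a\vee b\in\nabla,\ a\wedge b\in\Delta\}$. For $\mathbf{T}=Tw(\mathbf{B},\nabla,\Delta)$: $\mathsf{G}_2(\mathbf{T})=\{(a,b)\in\mathbf{T}:\Box a=a,\ \Box b=b\}$ and $\Delta_{\mathsf{G}}(\mathbf{T})=\{a\wedge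 b:(a,b)\in\mathsf{G}_2(\mathbf{T})\}$. -}

module Defs where

open import Level using (Level; _⊔_; suc)
open import Data.Product using (Σ; _×_; _,_)
open import Relation.Unary using (Pred; _∈_)
open import Algebra.Lattice.Bundles using (BooleanAlgebra)

record TBA (c ℓ : Level) : Set (suc (c ⊔ ℓ)) where
  field
    booleanAlgebra : BooleanAlgebra c ℓ
  open BooleanAlgebra booleanAlgebra public
  field
    □      : Carrier → Carrier
    □-cong : ∀ {a b} → a ≈ b → □ a ≈ □ b
    □-⊤    : □ ⊤ ≈ ⊤
    □-∧    : ∀ a b → □ (a ∧ b) ≈ □ a ∧ □ b
    □-≤    : ∀ a → □ a ∧ a ≈ □ a          -- □ a ≤ a
    □-□    : ∀ a → □ a ∧ □ (□ a) ≈ □ a    -- □ a ≤ □ □ a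

  infix 4 _≤_
  _≤_ : Carrier → Carrier → Set ℓ
  a ≤ b = a ∧ b ≈ a

  _⇒_ : Carrier → Carrier → Carrier
  a ⇒ b = ¬ a ∨ b

  ◇ : Carrier → Carrier
  ◇ a = ¬ □ (¬ a)

  -- Pseudocomplement in the Heyting algebra 𝒢(B): ¬_𝒢 a = □ (a → ⊥)
  ¬G : Carrier → Carrier
  ¬G a = □ (a ⇒ ⊥)

module _ {c ℓ : Level} (B : TBA c ℓ) where
  open TBA B

  record IsFilter {p : Level} (F : Pred Carrier p) : Set (c ⊔ ℓ ⊔ p) where
    field
      ⊤∈  : ⊤ ∈ F
      ∧∈  : ∀ {a b} → a ∈ F → b ∈ F → (a ∧ b) ∈ F
      up  : ∀ {a b} → a ≤ b → a ∈ F → b ∈ F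

  record IsIdeal {p : Level} (I : Pred Carrier p) : Set (c ⊔ ℓ ⊔ p) where
    field
      ⊥∈   : ⊥ ∈ I
      ∨∈   : ∀ {a b} → a ∈ I → b ∈ I → (a ∨ b) ∈ I
      down : ∀ {a b} → a ≤ b → b ∈ I → a ∈ I

  record IsOpenFilter {p : Level} (F : Pred Carrier p) : Set (c ⊔ ℓ ⊔ p) where
    field
      isFilter : IsFilter F
      □∈       : ∀ {a} → a ∈ F → □ a ∈ F

  record IsClosedIdeal {p : Level} (I : Pred Carrier p) : Set (c ⊔ ℓ ⊔ p) where
    field
      isIdeal : IsIdeal I
      ◇∈      : ∀ {a} → a ∈ I → ◇ a ∈ I

  InTw : {p q : Level} → Pred Carrier p → Pred Carrier q → Carrier × Carrier → Set (p ⊔ q)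
  InTw ∇ Δ (a , b) = ((a ∨ b) ∈ ∇) × ((a ∧ b) ∈ Δ)

  InG₂ : {p q : Level} → Pred Carrier p → Pred Carrier q → Carrier × Carrier → Set (p ⊔ q ⊔ ℓ)
  InG₂ ∇ Δ (a , b) = InTw ∇ Δ (a , b) × (□ a ≈ a) × (□ b ≈ b)

  InΔG : {p q : Level} → Pred Carrier p → Pred Carrier q → Pred Carrier (c ⊔ p ⊔ q ⊔ ℓ)
  InΔG ∇ Δ x = Σ (Carrier × Carrier) λ { (a , b) → InG₂ ∇ Δ (a , b) × (x ≈ a ∧ b) }

-- Since ¬G ¬G a ≈ □ ◇ a, it is open, and it lies in Δ because Δ is closed under ◇
-- and down-closed.  Every open element x of Δ belongs to Δ_G(T), witnessed by the
-- pair (x , ⊤): its join ⊤ lies in the filter ∇ and its meet is x.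
module Submission where

open import Defs
open import Level using (Level)
open import Relation.Unary using (Pred; _∈_)
open import Data.Product using (_,_)
import Algebra.Lattice.Properties.BooleanAlgebra as BooleanAlgebraProperties

module _ {c ℓ : Level} (B : TBA c ℓ) where
  open TBA B
  open BooleanAlgebraProperties booleanAlgebra using (∧-idem; ∧-identityʳ; ∨-identityʳ; ∨-zeroʳ)

  ≈⇒≤ : ∀ {a b} → a ≈ b → a ≤ b
  ≈⇒≤ {a} a≈b = trans (∧-congˡ (sym a≈b)) (∧-idem a)

  □-idem : ∀ a → □ (□ a) ≈ □ a
  □-idem a = trans (sym (□-≤ (□ a))) (trans (∧-comm _ _) (□-□ a))

  ¬G-open : ∀ a → □ (¬G a) ≈ ¬G a
  ¬G-open a = □-idem (a ⇒ ⊥)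

  ¬G¬G≈□◇ : ∀ a → ¬G (¬G a) ≈ □ (◇ a)
  ¬G¬G≈□◇ a = □-cong (trans (∨-identityʳ _) (¬-cong (□-cong (∨-identityʳ _))))

  □◇-closedIdeal : ∀ {q} {Δ : Pred Carrier q} → IsClosedIdeal B Δ →
                   ∀ {x} → x ∈ Δ → □ (◇ x) ∈ Δ
  □◇-closedIdeal isClosedIdeal {x} x∈Δ =
    IsIdeal.down isIdeal (□-≤ (◇ x)) (◇∈ x∈Δ)
    where open IsClosedIdeal isClosedIdeal

  module _ {p q : Level} {∇ : Pred Carrier p} {Δ : Pred Carrier q} where

    ΔG⊆Δ : IsIdeal B Δ → ∀ {x} → x ∈ InΔG B ∇ Δ → x ∈ Δ
    ΔG⊆Δ isIdeal (_ , ((_ , a∧b∈Δ) , _) , x≈a∧b) =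
      IsIdeal.down isIdeal (≈⇒≤ x≈a∧b) a∧b∈Δ

    open∈Δ⇒∈ΔG : IsFilter B ∇ → IsIdeal B Δ →
                 ∀ {x} → □ x ≈ x → x ∈ Δ → x ∈ InΔG B ∇ Δ
    open∈Δ⇒∈ΔG isFilter isIdeal {x} □x≈x x∈Δ =
      (x , ⊤) , ((x∨⊤∈∇ , x∧⊤∈Δ) , □x≈x , □-⊤) , sym (∧-identityʳ x)
      where
      x∨⊤∈∇ : (x ∨ ⊤) ∈ ∇
      x∨⊤∈∇ = IsFilter.up isFilter (≈⇒≤ (sym (∨-zeroʳ x))) (IsFilter.⊤∈ isFilter)
      x∧⊤∈Δ : (x ∧ ⊤) ∈ Δ
      x∧⊤∈Δ = IsIdeal.down isIdeal (≈⇒≤ (∧-identityʳ x)) x∈Δ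

lemma3p1p3 : {c ℓ p q : Level} (B : TBA c ℓ)
    (∇ : Pred (TBA.Carrier B) p) (Δ : Pred (TBA.Carrier B) q) →
    IsOpenFilter B ∇ → IsClosedIdeal B Δ →
    ∀ a → a ∈ InΔG B ∇ Δ → TBA.¬G B (TBA.¬G B a) ∈ InΔG B ∇ Δ
lemma3p1p3 B ∇ Δ isOpenFilter isClosedIdeal a a∈ΔG =
  open∈Δ⇒∈ΔG B (IsOpenFilter.isFilter isOpenFilter) isIdeal (¬G-open B (¬G a)) ¬G¬Ga∈Δ
  where
  open TBA B using (¬G)
  open IsClosedIdeal isClosedIdeal using (isIdeal)

  ¬G¬Ga∈Δ : ¬G (¬G a) ∈ Δ
  ¬G¬Ga∈Δ = IsIdeal.down isIdeal (≈⇒≤ B (¬G¬G≈□◇ B a))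
              (□◇-closedIdeal B isClosedIdeal (ΔG⊆Δ B {∇ = ∇} isIdeal a∈ΔG))
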